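{- Let $m>n$ with $n\equiv 2\pmod 4$, and let $C$ be a Hamilton cycle of $G(m,n)$. Then among any three consecutive columns of the grid, at least one contains a straight of $C$.
   Context: $G(m,n)$ is the graph on cells $\{1,\dots,m\}\times\{1,\dots,n\}$ with $(a,b),(c,d)$ adjacent iff $|a-c|+|b-d|=1$; column $x$ is the set of $n$ cells with first coordinate $x$. A Hamilton cycle is a cycle through every cell. A turn of a cycle is a cell whose two incident cycle edges are one horizontal and one vertical; a straight is a cell of the cycle that is not a turn. -}

module Defs where

open import Data.Nat using (ℕ; zero; suc; _+_; _*_; ∣_-_∣)
open import Data.Fin using (Fin; toℕ)
open import Data.Product using (_×_; Σ; ∃; _,_; proj₁; proj₂)
open import Data.Sum using (_⊎_)
open import Relation.Binary.PropositionalEquality using (_≡_)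
open import Relation.Nullary using (¬_)

-- Cells of G(m,n): (x , y) with x : Fin m (column index), y : Fin n.
-- (0-indexed: Fin m stands for {1..m}.)
Cell : ℕ → ℕ → Set
Cell m n = Fin m × Fin n

Adjacent : ∀ {m n} → Cell m n → Cell m n → Set
Adjacent (a , b) (c , d) = ∣ toℕ a - toℕ c ∣ + ∣ toℕ b - toℕ d ∣ ≡ 1

CycSucc : ∀ {L} → Fin L → Fin L → Set
CycSucc {L} i j = (suc (toℕ i) ≡ toℕ j) ⊎ (suc (toℕ i) ≡ L × toℕ j ≡ 0)

record HamiltonCycle (m n : ℕ) : Set where
  field
    visit    : Fin (m * n) → Cell m n
    injective  : ∀ i j → visit i ≡ visit j → i ≡ j
    surjective : ∀ c → ∃ λ i → visit i ≡ c
    adjacent   : ∀ i j → CycSucc i j → Adjacent (visit i) (visit j)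

VerticalEdge : ∀ {m n} → Cell m n → Cell m n → Set
VerticalEdge u v = proj₁ u ≡ proj₁ v

HorizontalEdge : ∀ {m n} → Cell m n → Cell m n → Set
HorizontalEdge u v = proj₂ u ≡ proj₂ v

Turn : ∀ {m n} → HamiltonCycle m n → Fin (m * n) → Set
Turn C i = Σ _ λ h → Σ _ λ j → CycSucc h i × CycSucc i j ×
  ((HorizontalEdge (visit h) (visit i) × VerticalEdge (visit i) (visit j))
   ⊎ (VerticalEdge (visit h) (visit i) × HorizontalEdge (visit i) (visit j)))
  where open HamiltonCycle C

Straight : ∀ {m n} → HamiltonCycle m n → Fin (m * n) → Set
Straight C i = ¬ Turn C i

-- Suppose columns x, x+1, x+2 contain only turns. In a column of turns every cell has exactly one
-- vertical cycle edge, and working up from the bottom these edges pair rows 2k and 2k+1. For each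
-- such pair of rows exactly one of the two horizontal edges between columns x and x+1 lies on C:
-- both would close a 4-cycle with the vertical edges in columns x and x+1, and neither would make
-- both cells of column x+1 turn into column x+2, closing a 4-cycle there. So C crosses between
-- columns x and x+1 exactly n/2 times, an odd number when n ≡ 2 (mod 4); but a closed cycle crosses
-- any vertical line an even number of times, as the xor-sum of the crossing indicator telescopes.
module Submission where

open import Defs
open import Algebra.Bundles using (CommutativeMonoid; CommutativeRing)
open import Data.Bool using (Bool; true; false; not; _xor_)
open import Data.Bool.Properties
  using (xor-∧-commutativeRing; xor-assoc; xor-identityʳ; xor-same; not-involutive)
open import Data.Empty using (⊥; ⊥-elim)
open import Data.Fin
  using (Fin; zero; suc; toℕ; fromℕ; fromℕ<; inject₁; remQuot; combine; _↑ˡ_; _↑ʳ_)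
open import Data.Fin.Properties
  using ( toℕ-injective; toℕ<n; toℕ-fromℕ<; toℕ-fromℕ; toℕ-inject₁; splitAt-↑ˡ; splitAt-↑ʳ
        ; remQuot-combine; combine-remQuot; any?)
  renaming (_≟_ to _≟ᶠ_)
import Data.Fin.Properties as Finₚ
open import Data.Fin.Permutation using (Permutation′; permutation)
open import Data.Nat using (ℕ; zero; suc; _+_; _*_; ∣_-_∣; _<_; _≤_; _%_; _/_; _<?_; _≤?_; z≤n; s≤s; s≤s⁻¹)
  renaming (_≟_ to _≟ℕ_)
open import Data.Nat.DivMod using (m≡m%n+[m/n]*n)
open import Data.Nat.Properties
open import Data.Product using (∃; _×_; _,_; proj₁; proj₂; uncurry)
open import Data.Sum using (_⊎_; inj₁; inj₂; [_,_])
open import Function using (_∘_)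
open import Relation.Binary.PropositionalEquality
  using (_≡_; _≢_; ≢-sym; refl; sym; trans; cong; cong₂; subst; module ≡-Reasoning)
open import Relation.Nullary using (¬_; Dec; yes; no; does)
open import Relation.Nullary.Decidable using (_×-dec_; _⊎-dec_; ¬?; dec-true; dec-false; decidable-stable)

xor-commutativeMonoid : CommutativeMonoid _ _
xor-commutativeMonoid = CommutativeRing.+-commutativeMonoid xor-∧-commutativeRing

open import Algebra.Properties.CommutativeMonoid.Sum xor-commutativeMonoid
  using (sum; sum-cong-≗; sum-replicate-zero; ∑-distrib-+; sum-permute)

sum-↑ : ∀ p q (f : Fin (p + q) → Bool) →
  sum f ≡ sum (λ i → f (i ↑ˡ q)) xor sum (λ j → f (p ↑ʳ j))
sum-↑ zero    q f = refl
sum-↑ (suc p) q f = trans (cong (f zero xor_) (sum-↑ p q (f ∘ suc)))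
                          (sym (xor-assoc (f zero) _ _))

sum-remQuot : ∀ m n (F : Fin m → Fin n → Bool) →
  sum (λ k → uncurry F (remQuot {m} n k)) ≡ sum (λ a → sum (F a))
sum-remQuot zero    n F = refl
sum-remQuot (suc m) n F = begin
  sum (λ k → uncurry F (remQuot {suc m} n k))
    ≡⟨ sum-↑ n (m * n) _ ⟩
  sum (λ b → uncurry F (remQuot {suc m} n (b ↑ˡ m * n)))
    xor sum (λ k → uncurry F (remQuot {suc m} n (n ↑ʳ k)))
    ≡⟨ cong₂ _xor_ (sum-cong-≗ first-row) (sum-cong-≗ later-rows) ⟩
  sum (F zero) xor sum (λ k → uncurry (F ∘ suc) (remQuot {m} n k))
    ≡⟨ cong (sum (F zero) xor_) (sum-remQuot m n (F ∘ suc)) ⟩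
  sum (λ a → sum (F a)) ∎
  where
  open ≡-Reasoning
  first-row : ∀ b → uncurry F (remQuot {suc m} n (b ↑ˡ m * n)) ≡ F zero b
  first-row b rewrite splitAt-↑ˡ n b (m * n) = refl
  later-rows : ∀ k → uncurry F (remQuot {suc m} n (n ↑ʳ k)) ≡ uncurry (F ∘ suc) (remQuot {m} n k)
  later-rows k rewrite splitAt-↑ʳ n (m * n) k = refl

sum-supported-on-successive : ∀ {m} (F : Fin m → Bool) (a b : Fin m) → toℕ b ≡ suc (toℕ a) →
  (∀ c → c ≢ a → c ≢ b → F c ≡ false) → sum F ≡ F a xor F b
sum-supported-on-successive F zero    zero          ()   _
sum-supported-on-successive F zero    (suc (suc _)) ()   _
sum-supported-on-successive F (suc _) zero          ()   _
sum-supported-on-successive {suc (suc m)} F zero (suc zero) refl off = begin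
  F zero xor (F (suc zero) xor sum (λ c → F (suc (suc c))))
    ≡⟨ cong (λ s → F zero xor (F (suc zero) xor s)) rest-vanishes ⟩
  F zero xor (F (suc zero) xor false)
    ≡⟨ cong (F zero xor_) (xor-identityʳ _) ⟩
  F zero xor F (suc zero) ∎
  where
  open ≡-Reasoning
  rest-vanishes : sum (λ c → F (suc (suc c))) ≡ false
  rest-vanishes = trans (sum-cong-≗ (λ c → off (suc (suc c)) (λ ()) (λ ()))) (sum-replicate-zero m)
sum-supported-on-successive F (suc a) (suc b) b≡1+a off =
  trans (cong (_xor sum (F ∘ suc)) (off zero (λ ()) (λ ())))
        (sum-supported-on-successive (F ∘ suc) a b (suc-injective b≡1+a)
          (λ c c≢a c≢b → off (suc c) (c≢a ∘ Finₚ.suc-injective) (c≢b ∘ Finₚ.suc-injective)))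

odd : ℕ → Bool
odd zero    = false
odd (suc k) = not (odd k)

odd-*2 : ∀ q → odd (q * 2) ≡ false
odd-*2 zero    = refl
odd-*2 (suc q) = trans (not-involutive _) (odd-*2 q)

sum-pairs : ∀ K (f : Fin (K * 2) → Bool) →
  (∀ k (b c : Fin (K * 2)) → toℕ b ≡ k * 2 → toℕ c ≡ suc (k * 2) → f b xor f c ≡ true) →
  sum f ≡ odd K
sum-pairs zero    f paired = refl
sum-pairs (suc K) f paired = begin
  f zero xor (f (suc zero) xor sum (λ b → f (suc (suc b))))
    ≡⟨ sym (xor-assoc (f zero) _ _) ⟩
  (f zero xor f (suc zero)) xor sum (λ b → f (suc (suc b)))
    ≡⟨ cong₂ _xor_ (paired 0 zero (suc zero) refl refl) (sum-pairs K _ later-pairs) ⟩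
  true xor odd K ∎
  where
  open ≡-Reasoning
  later-pairs : ∀ k (b c : Fin (K * 2)) → toℕ b ≡ k * 2 → toℕ c ≡ suc (k * 2) →
    f (suc (suc b)) xor f (suc (suc c)) ≡ true
  later-pairs k b c b≡2k c≡2k+1 =
    paired (suc k) (suc (suc b)) (suc (suc c)) (cong (2 +_) b≡2k) (cong (2 +_) c≡2k+1)

module CyclicOrder (N : ℕ) where

  CycSucc-functional : ∀ {i j k : Fin (suc N)} → CycSucc i j → CycSucc i k → j ≡ k
  CycSucc-functional (inj₁ i→j) (inj₁ i→k) = toℕ-injective (trans (sym i→j) i→k)
  CycSucc-functional {j = j} (inj₁ i→j) (inj₂ (last , _)) = ⊥-elim (<-irrefl (trans (sym i→j) last) (toℕ<n j))
  CycSucc-functional {k = k} (inj₂ (last , _)) (inj₁ i→k) = ⊥-elim (<-irrefl (trans (sym i→k) last) (toℕ<n k))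
  CycSucc-functional (inj₂ (_ , j≡0)) (inj₂ (_ , k≡0)) = toℕ-injective (trans j≡0 (sym k≡0))

  CycSucc-injective : ∀ {i j k : Fin (suc N)} → CycSucc i k → CycSucc j k → i ≡ j
  CycSucc-injective (inj₁ i→k) (inj₁ j→k) = toℕ-injective (suc-injective (trans i→k (sym j→k)))
  CycSucc-injective (inj₁ i→k) (inj₂ (_ , k≡0)) = ⊥-elim (1+n≢0 (trans i→k k≡0))
  CycSucc-injective (inj₂ (_ , k≡0)) (inj₁ j→k) = ⊥-elim (1+n≢0 (trans j→k k≡0))
  CycSucc-injective (inj₂ (i-last , _)) (inj₂ (j-last , _)) =
    toℕ-injective (suc-injective (trans i-last (sym j-last)))

  next : Fin (suc N) → Fin (suc N)
  next i with suc (toℕ i) <? suc N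
  ... | yes i+1<L = fromℕ< i+1<L
  ... | no  _     = zero

  next-CycSucc : ∀ i → CycSucc i (next i)
  next-CycSucc i with suc (toℕ i) <? suc N
  ... | yes i+1<L = inj₁ (sym (toℕ-fromℕ< i+1<L))
  ... | no  i+1≮L = inj₂ (≤-antisym (toℕ<n i) (≮⇒≥ i+1≮L) , refl)

  prev : Fin (suc N) → Fin (suc N)
  prev zero    = fromℕ N
  prev (suc i) = inject₁ i

  prev-CycSucc : ∀ i → CycSucc (prev i) i
  prev-CycSucc zero    = inj₂ (cong suc (toℕ-fromℕ N) , refl)
  prev-CycSucc (suc i) = inj₁ (cong suc (toℕ-inject₁ i))

  CycSucc⇒next : ∀ {i j} → CycSucc i j → next i ≡ j
  CycSucc⇒next {i} = CycSucc-functional (next-CycSucc i)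

  CycSucc⇒prev : ∀ {i j} → CycSucc i j → prev j ≡ i
  CycSucc⇒prev {j = j} = CycSucc-injective (prev-CycSucc j)

  next-injective : ∀ {i j} → next i ≡ next j → i ≡ j
  next-injective {i} {j} eq = CycSucc-injective (next-CycSucc i) (subst (CycSucc j) (sym eq) (next-CycSucc j))

  next-prev : ∀ i → next (prev i) ≡ i
  next-prev i = CycSucc⇒next (prev-CycSucc i)

  prev-next : ∀ i → prev (next i) ≡ i
  prev-next i = CycSucc⇒prev (next-CycSucc i)

  next^ : ℕ → Fin (suc N) → Fin (suc N)
  next^ zero    i = i
  next^ (suc k) i = next (next^ k i)

  toℕ-next^ : ∀ i k → k ≤ N →
    toℕ (next^ k i) ≡ toℕ i + k ⊎ toℕ (next^ k i) + suc N ≡ toℕ i + k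
  toℕ-next^ i zero    _   = inj₁ (sym (+-identityʳ _))
  toℕ-next^ i (suc k) k<N with toℕ-next^ i k (<⇒≤ k<N) | next-CycSucc (next^ k i)
  ... | inj₁ no-wrap | inj₁ step = inj₁ (trans (sym step) (trans (cong suc no-wrap) (sym (+-suc _ k))))
  ... | inj₁ no-wrap | inj₂ (last , wrap) =
    inj₂ (trans (cong (_+ suc N) wrap) (trans (sym last) (trans (cong suc no-wrap) (sym (+-suc _ k)))))
  ... | inj₂ wrapped | inj₁ step =
    inj₂ (trans (cong (_+ suc N) (sym step)) (trans (cong suc wrapped) (sym (+-suc _ k))))
  ... | inj₂ wrapped | inj₂ (last , _) = ⊥-elim (<-irrefl twice-around (+-mono-<-≤ (toℕ<n i) (m≤n⇒m≤1+n k<N)))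
    where
    twice-around : toℕ i + suc k ≡ suc N + suc N
    twice-around = trans (+-suc (toℕ i) k) (trans (cong suc (sym wrapped)) (cong (_+ suc N) last))

  next^-irreflexive : ∀ k i → suc k ≤ N → next^ (suc k) i ≢ i
  next^-irreflexive k i k<N fixed with toℕ-next^ i (suc k) k<N
  ... | inj₁ no-wrap = m+1+n≢m (toℕ i) (trans (sym no-wrap) (cong toℕ fixed))
  ... | inj₂ wrapped = <-irrefl refl (subst (_≤ N) (sym L≡k+1) k<N)
    where
    L≡k+1 : suc N ≡ suc k
    L≡k+1 = +-cancelˡ-≡ (toℕ i) _ _ (trans (cong (λ j → toℕ j + suc N) (sym fixed)) wrapped)

  sum-xor-next : ∀ (f : Fin (suc N) → Bool) → sum (λ i → f i xor f (next i)) ≡ false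
  sum-xor-next f = begin
    sum (λ i → f i xor f (next i))  ≡⟨ ∑-distrib-+ f (f ∘ next) ⟩
    sum f xor sum (f ∘ next)        ≡⟨ cong (sum f xor_) (sym (sum-permute f rotation)) ⟩
    sum f xor sum f                 ≡⟨ xor-same (sum f) ⟩
    false                           ∎
    where
    open ≡-Reasoning
    rotation : Permutation′ (suc N)
    rotation = permutation next prev next-prev prev-next

OneApart : ℕ → ℕ → Set
OneApart u v = suc u ≡ v ⊎ suc v ≡ u

OneApart-sym : ∀ {u v} → OneApart u v → OneApart v u
OneApart-sym (inj₁ e) = inj₂ e
OneApart-sym (inj₂ e) = inj₁ e

OneApart-irreflexive : ∀ {u} → ¬ OneApart u u
OneApart-irreflexive (inj₁ e) = 1+n≢n e
OneApart-irreflexive (inj₂ e) = 1+n≢n e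

∣-∣≡1⇒OneApart : ∀ u v → ∣ u - v ∣ ≡ 1 → OneApart u v
∣-∣≡1⇒OneApart zero    v       e = inj₁ (sym e)
∣-∣≡1⇒OneApart (suc u) zero    e = inj₂ (cong suc (sym (suc-injective e)))
∣-∣≡1⇒OneApart (suc u) (suc v) e with ∣-∣≡1⇒OneApart u v e
... | inj₁ up   = inj₁ (cong suc up)
... | inj₂ down = inj₂ (cong suc down)

Adjacent⇒OneApart : ∀ {m n} (u v : Cell m n) → Adjacent u v →
  (toℕ (proj₁ u) ≡ toℕ (proj₁ v) × OneApart (toℕ (proj₂ u)) (toℕ (proj₂ v)))
  ⊎ (toℕ (proj₂ u) ≡ toℕ (proj₂ v) × OneApart (toℕ (proj₁ u)) (toℕ (proj₁ v)))
Adjacent⇒OneApart (a , b) (c , d) adj with ∣ toℕ a - toℕ c ∣ in da | ∣ toℕ b - toℕ d ∣ in db | adj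
... | zero     | _    | db≡1 = inj₁ (∣m-n∣≡0⇒m≡n da , ∣-∣≡1⇒OneApart _ _ (trans db db≡1))
... | suc zero | zero | _    = inj₂ (∣m-n∣≡0⇒m≡n db , ∣-∣≡1⇒OneApart _ _ da)

Across : ℕ → ℕ → ℕ → Set
Across x c c′ = (c ≡ x × c′ ≡ suc x) ⊎ (c ≡ suc x × c′ ≡ x)

Across-functional : ∀ {x c c′ c″} → Across x c c′ → Across x c c″ → c′ ≡ c″
Across-functional (inj₁ (_ , e′)) (inj₁ (_ , e″)) = trans e′ (sym e″)
Across-functional (inj₂ (_ , e′)) (inj₂ (_ , e″)) = trans e′ (sym e″)
Across-functional (inj₁ (c≡x , _)) (inj₂ (c≡1+x , _)) = ⊥-elim (1+n≢n (trans (sym c≡1+x) c≡x))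
Across-functional (inj₂ (c≡1+x , _)) (inj₁ (c≡x , _)) = ⊥-elim (1+n≢n (trans (sym c≡1+x) c≡x))

Across-irreflexive : ∀ {x c} → ¬ Across x c c
Across-irreflexive (inj₁ (c≡x , c≡1+x)) = 1+n≢n (trans (sym c≡1+x) c≡x)
Across-irreflexive (inj₂ (c≡1+x , c≡x)) = 1+n≢n (trans (sym c≡1+x) c≡x)

Across⇒≤?-xor : ∀ {x c c′} → Across x c c′ → does (c ≤? x) xor does (c′ ≤? x) ≡ true
Across⇒≤?-xor {x} (inj₁ (refl , refl)) = cong₂ _xor_ (dec-true (x ≤? x) ≤-refl) (dec-false (suc x ≤? x) 1+n≰n)
Across⇒≤?-xor {x} (inj₂ (refl , refl)) = cong₂ _xor_ (dec-false (suc x ≤? x) 1+n≰n) (dec-true (x ≤? x) ≤-refl)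

≤?-xor⇒Across : ∀ x {c c′} → c ≡ c′ ⊎ OneApart c c′ → (c≤x? : Dec (c ≤ x)) (c′≤x? : Dec (c′ ≤ x)) →
  does c≤x? xor does c′≤x? ≡ true → Across x c c′
≤?-xor⇒Across x _ (yes _) (yes _) ()
≤?-xor⇒Across x _ (no _)  (no _)  ()
≤?-xor⇒Across x (inj₁ refl)        (yes c≤x) (no c′≰x) _ = ⊥-elim (c′≰x c≤x)
≤?-xor⇒Across x {c} (inj₂ (inj₁ refl)) (yes c≤x) (no c′≰x) _ = inj₁ (c≡x , cong suc c≡x)
  where
  c≡x : c ≡ x
  c≡x = ≤-antisym c≤x (s≤s⁻¹ (≰⇒> c′≰x))
≤?-xor⇒Across x (inj₂ (inj₂ refl)) (yes c≤x) (no c′≰x) _ = ⊥-elim (c′≰x (≤-trans (n≤1+n _) c≤x))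
≤?-xor⇒Across x (inj₁ refl)        (no c≰x) (yes c′≤x) _ = ⊥-elim (c≰x c′≤x)
≤?-xor⇒Across x (inj₂ (inj₁ refl)) (no c≰x) (yes c′≤x) _ = ⊥-elim (c≰x (≤-trans (n≤1+n _) c′≤x))
≤?-xor⇒Across x {c′ = c′} (inj₂ (inj₂ refl)) (no c≰x) (yes c′≤x) _ = inj₂ (cong suc c′≡x , c′≡x)
  where
  c′≡x : c′ ≡ x
  c′≡x = ≤-antisym c′≤x (s≤s⁻¹ (≰⇒> c≰x))

-- suc m′ * suc n′ reduces to suc N for N = n′ + m′ * suc n′, so positions along C carry the cyclic
-- order on Fin (suc N); long says that C has at least 5 cells.
module HamiltonCycleProperties (m′ n′ : ℕ) (C : HamiltonCycle (suc m′) (suc n′))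
                               (long : 4 ≤ n′ + m′ * suc n′) where

  open HamiltonCycle C
  open CyclicOrder (n′ + m′ * suc n′) public

  Position : Set
  Position = Fin (suc m′ * suc n′)

  col row : Position → ℕ
  col i = toℕ (proj₁ (visit i))
  row i = toℕ (proj₂ (visit i))

  cell : Fin (suc m′) → Fin (suc n′) → Position
  cell a b = proj₁ (surjective (a , b))

  visit-cell : ∀ a b → visit (cell a b) ≡ (a , b)
  visit-cell a b = proj₂ (surjective (a , b))

  col-cell : ∀ a b → col (cell a b) ≡ toℕ a
  col-cell a b = cong (toℕ ∘ proj₁) (visit-cell a b)

  row-cell : ∀ a b → row (cell a b) ≡ toℕ b
  row-cell a b = cong (toℕ ∘ proj₂) (visit-cell a b)

  position-at : ∀ {c r} → c < suc m′ → r < suc n′ → ∃ λ p → col p ≡ c × row p ≡ r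
  position-at c<m r<n = cell (fromℕ< c<m) (fromℕ< r<n)
                      , trans (col-cell _ _) (toℕ-fromℕ< c<m)
                      , trans (row-cell _ _) (toℕ-fromℕ< r<n)

  position-injective : ∀ {i j} → col i ≡ col j → row i ≡ row j → i ≡ j
  position-injective c r = injective _ _ (cong₂ _,_ (toℕ-injective c) (toℕ-injective r))

  sum-over-cells : ∀ (f : Position → Bool) → sum f ≡ sum (λ a → sum (λ b → f (cell a b)))
  sum-over-cells f = trans (sum-permute f (permutation from-index to-index from-to to-from))
                           (sum-remQuot (suc m′) (suc n′) (λ a b → f (cell a b)))
    where
    from-index : Position → Position
    from-index k = uncurry cell (remQuot {suc m′} (suc n′) k)
    to-index : Position → Position
    to-index i = uncurry combine (visit i)
    from-to : ∀ i → from-index (to-index i) ≡ i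
    from-to i rewrite remQuot-combine (proj₁ (visit i)) (proj₂ (visit i)) =
      injective _ _ (visit-cell (proj₁ (visit i)) (proj₂ (visit i)))
    to-from : ∀ k → to-index (from-index k) ≡ k
    to-from k rewrite visit-cell (proj₁ (remQuot {suc m′} (suc n′) k)) (proj₂ (remQuot {suc m′} (suc n′) k)) =
      combine-remQuot {suc m′} (suc n′) k

  Linked : Position → Position → Set
  Linked i j = next i ≡ j ⊎ next j ≡ i

  Linked-sym : ∀ {i j} → Linked i j → Linked j i
  Linked-sym (inj₁ e) = inj₂ e
  Linked-sym (inj₂ e) = inj₁ e

  Linked-prev : ∀ i → Linked i (prev i)
  Linked-prev i = inj₂ (next-prev i)

  Linked-to-position : ∀ {i j k} → Linked i j → col j ≡ col k → row j ≡ row k → Linked i k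
  Linked-to-position i~j c r = subst (Linked _) (position-injective c r) i~j

  Linked⇒next⊎prev : ∀ {i j} → Linked i j → j ≡ next i ⊎ j ≡ prev i
  Linked⇒next⊎prev (inj₁ i→j) = inj₁ (sym i→j)
  Linked⇒next⊎prev {i} {j} (inj₂ j→i) = inj₂ (trans (sym (prev-next j)) (cong prev j→i))

  next-irreflexive : ∀ i → next i ≢ i
  next-irreflexive i = next^-irreflexive 0 i (≤-trans (s≤s z≤n) long)

  next²-irreflexive : ∀ i → next (next i) ≢ i
  next²-irreflexive i = next^-irreflexive 1 i (≤-trans (s≤s (s≤s z≤n)) long)

  Linked-irreflexive : ∀ {i} → ¬ Linked i i
  Linked-irreflexive {i} (inj₁ e) = next-irreflexive i e
  Linked-irreflexive {i} (inj₂ e) = next-irreflexive i e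

  Step : Position → Position → Set
  Step i j = (col i ≡ col j × OneApart (row i) (row j)) ⊎ (row i ≡ row j × OneApart (col i) (col j))

  Linked⇒Step : ∀ {i j} → Linked i j → Step i j
  Linked⇒Step {i} (inj₁ refl) = Adjacent⇒OneApart _ _ (adjacent i (next i) (next-CycSucc i))
  Linked⇒Step {j = j} (inj₂ refl) with Adjacent⇒OneApart _ _ (adjacent j (next j) (next-CycSucc j))
  ... | inj₁ (c , r) = inj₁ (sym c , OneApart-sym r)
  ... | inj₂ (r , c) = inj₂ (sym r , OneApart-sym c)

  Linked-vertical : ∀ {i j} → Linked i j → col i ≡ col j → OneApart (row i) (row j)
  Linked-vertical i~j c with Linked⇒Step i~j
  ... | inj₁ (_ , r) = r
  ... | inj₂ (_ , c′) = ⊥-elim (OneApart-irreflexive (subst (OneApart _) (sym c) c′))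

  Linked-horizontal : ∀ {i j} → Linked i j → row i ≡ row j → OneApart (col i) (col j)
  Linked-horizontal i~j r with Linked⇒Step i~j
  ... | inj₁ (_ , r′) = ⊥-elim (OneApart-irreflexive (subst (OneApart _) (sym r) r′))
  ... | inj₂ (_ , c) = c

  Linked-changing-column : ∀ {i j} → Linked i j → col i ≢ col j → row i ≡ row j
  Linked-changing-column i~j c≢ with Linked⇒Step i~j
  ... | inj₁ (c , _) = ⊥-elim (c≢ c)
  ... | inj₂ (r , _) = r

  Linked-columns : ∀ {i j} → Linked i j → col i ≡ col j ⊎ OneApart (col i) (col j)
  Linked-columns i~j with Linked⇒Step i~j
  ... | inj₁ (c , _) = inj₁ c
  ... | inj₂ (_ , c) = inj₂ c

  TurnShape : Position → Set
  TurnShape i = (row (prev i) ≡ row i × col i ≡ col (next i)) ⊎ (col (prev i) ≡ col i × row i ≡ row (next i))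

  turn-shape : ∀ {i} → Turn C i → TurnShape i
  turn-shape {i} (h , j , h→i , i→j , shape)
    with refl ← CycSucc⇒prev h→i | refl ← CycSucc⇒next i→j | shape
  ... | inj₁ (r , c) = inj₁ (cong toℕ r , cong toℕ c)
  ... | inj₂ (c , r) = inj₂ (cong toℕ c , cong toℕ r)

  turn-vertical-link : ∀ {i} → Turn C i → ∃ λ j → Linked i j × col i ≡ col j
  turn-vertical-link {i} turn with turn-shape turn
  ... | inj₁ (_ , c) = next i , inj₁ refl , c
  ... | inj₂ (c , _) = prev i , Linked-prev i , sym c

  turn-horizontal-link : ∀ {i} → Turn C i → ∃ λ j → Linked i j × row i ≡ row j
  turn-horizontal-link {i} turn with turn-shape turn
  ... | inj₁ (r , _) = prev i , Linked-prev i , sym r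
  ... | inj₂ (_ , r) = next i , inj₁ refl , r

  turn-vertical-link-unique : ∀ {i j k} → Turn C i → Linked i j → Linked i k →
    col i ≡ col j → col i ≡ col k → j ≡ k
  turn-vertical-link-unique {i} {j} {k} turn i~j i~k cj ck =
    go (Linked⇒next⊎prev i~j) (Linked⇒next⊎prev i~k) (turn-shape turn)
    where
    not-both : ∀ {l} → Linked i l → col i ≡ col l → row i ≡ row l → ⊥
    not-both i~l c r with refl ← position-injective c r = Linked-irreflexive i~l
    go : j ≡ next i ⊎ j ≡ prev i → k ≡ next i ⊎ k ≡ prev i → TurnShape i → j ≡ k
    go (inj₁ refl) (inj₁ refl) _                 = refl
    go (inj₂ refl) (inj₂ refl) _                 = refl
    go (inj₁ refl) (inj₂ refl) (inj₁ (r , _))   = ⊥-elim (not-both i~k ck (sym r))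
    go (inj₁ refl) (inj₂ refl) (inj₂ (_ , r))   = ⊥-elim (not-both i~j cj r)
    go (inj₂ refl) (inj₁ refl) (inj₁ (r , _))   = ⊥-elim (not-both i~j cj (sym r))
    go (inj₂ refl) (inj₁ refl) (inj₂ (_ , r))   = ⊥-elim (not-both i~k ck r)

  Linked-continues : ∀ {a b c} → next a ≡ b → Linked b c → c ≢ a → next b ≡ c
  Linked-continues _   (inj₁ b→c) _   = b→c
  Linked-continues a→b (inj₂ c→b) c≢a = ⊥-elim (c≢a (next-injective (trans c→b (sym a→b))))

  no-directed-4-cycle : ∀ {p₁ p₂ p₃ p₄} → next p₁ ≡ p₂ → Linked p₂ p₃ → Linked p₃ p₄ → Linked p₄ p₁ →
    p₁ ≢ p₃ → p₂ ≢ p₄ → ⊥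
  no-directed-4-cycle {p₁} {p₂} {p₃} {p₄} e₁ l₂₃ l₃₄ l₄₁ p₁≢p₃ p₂≢p₄ =
    next^-irreflexive 3 p₁ long (trans (cong next (trans (cong next (trans (cong next e₁) e₂)) e₃)) e₄)
    where
    e₂ : next p₂ ≡ p₃
    e₂ = Linked-continues e₁ l₂₃ (p₁≢p₃ ∘ sym)
    e₃ : next p₃ ≡ p₄
    e₃ = Linked-continues e₂ l₃₄ (p₂≢p₄ ∘ sym)
    e₄ : next p₄ ≡ p₁
    e₄ = Linked-continues e₃ l₄₁ p₁≢p₃

  no-4-cycle : ∀ {p₁ p₂ p₃ p₄} → Linked p₁ p₂ → Linked p₂ p₃ → Linked p₃ p₄ → Linked p₄ p₁ →
    p₁ ≢ p₃ → p₂ ≢ p₄ → ⊥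
  no-4-cycle (inj₁ e₁) l₂₃ l₃₄ l₄₁ p₁≢p₃ p₂≢p₄ = no-directed-4-cycle e₁ l₂₃ l₃₄ l₄₁ p₁≢p₃ p₂≢p₄
  no-4-cycle (inj₂ e₁) l₂₃ l₃₄ l₄₁ p₁≢p₃ p₂≢p₄ =
    no-directed-4-cycle e₁ (Linked-sym l₄₁) (Linked-sym l₃₄) (Linked-sym l₂₃) p₂≢p₄ p₁≢p₃

  links : Position → Position → Bool
  links p q = does (next p ≟ᶠ q) xor does (next q ≟ᶠ p)

  links-true⇒Linked : ∀ p q → links p q ≡ true → Linked p q
  links-true⇒Linked p q eq with next p ≟ᶠ q | next q ≟ᶠ p
  ... | yes p→q | _       = inj₁ p→q
  ... | no _    | yes q→p = inj₂ q→p
  links-true⇒Linked p q () | no _ | no _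

  links-false⇒¬Linked : ∀ p q → links p q ≡ false → ¬ Linked p q
  links-false⇒¬Linked p q eq with next p ≟ᶠ q | next q ≟ᶠ p
  ... | yes p→q | yes q→p = λ _ → next²-irreflexive p (trans (cong next p→q) q→p)
  ... | no p↛q  | no q↛p  = [ p↛q , q↛p ]
  links-false⇒¬Linked p q () | yes _ | no _
  links-false⇒¬Linked p q () | no _  | yes _

  module Crossings (x : ℕ) where

    crosses : Position → Bool
    crosses i = does (col i ≤? x) xor does (col (next i) ≤? x)

    crosses⇒Across : ∀ i → crosses i ≡ true → Across x (col i) (col (next i))
    crosses⇒Across i = ≤?-xor⇒Across x (Linked-columns (inj₁ refl)) (col i ≤? x) (col (next i) ≤? x)

    crosses-elsewhere : ∀ i → col i ≢ x → col i ≢ suc x → crosses i ≡ false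
    crosses-elsewhere i c≢x c≢1+x with crosses i in eq
    ... | false = refl
    ... | true with crosses⇒Across i eq
    ...   | inj₁ (c≡x , _)   = ⊥-elim (c≢x c≡x)
    ...   | inj₂ (c≡1+x , _) = ⊥-elim (c≢1+x c≡1+x)

    crosses-toward : ∀ p q → row p ≡ row q → Across x (col p) (col q) → crosses p ≡ does (next p ≟ᶠ q)
    crosses-toward p q r across with next p ≟ᶠ q
    ... | yes refl = Across⇒≤?-xor across
    ... | no p↛q with crosses p in eq
    ...   | false = refl
    ...   | true  = ⊥-elim (p↛q (position-injective same-col same-row))
      where
      across-next : Across x (col p) (col (next p))
      across-next = crosses⇒Across p eq
      same-col : col (next p) ≡ col q
      same-col = Across-functional across-next across
      same-row : row (next p) ≡ row q
      same-row = trans (sym (Linked-changing-column (inj₁ refl) column-changes)) r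
        where
        column-changes : col p ≢ col (next p)
        column-changes c = Across-irreflexive (subst (Across x _) (sym c) across-next)

    sum-crosses : sum crosses ≡ false
    sum-crosses = sum-xor-next (λ i → does (col i ≤? x))

  even-links-across : ∀ a a′ → toℕ a′ ≡ suc (toℕ a) → sum (λ b → links (cell a b) (cell a′ b)) ≡ false
  even-links-across a a′ a′≡1+a = begin
    sum (λ b → links (cell a b) (cell a′ b))
      ≡⟨ sum-cong-≗ (λ b → sym (cong₂ _xor_ (rightward b) (leftward b))) ⟩
    sum (λ b → crosses (cell a b) xor crosses (cell a′ b))
      ≡⟨ ∑-distrib-+ (λ b → crosses (cell a b)) (λ b → crosses (cell a′ b)) ⟩
    column-crossings a xor column-crossings a′
      ≡⟨ sum-supported-on-successive column-crossings a a′ a′≡1+a elsewhere ⟨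
    sum column-crossings
      ≡⟨ sum-over-cells crosses ⟨
    sum crosses
      ≡⟨ sum-crosses ⟩
    false ∎
    where
    open ≡-Reasoning
    open Crossings (toℕ a)
    column-crossings : Fin (suc m′) → Bool
    column-crossings c = sum (λ b → crosses (cell c b))
    col-a′ : ∀ b → col (cell a′ b) ≡ suc (toℕ a)
    col-a′ b = trans (col-cell a′ b) a′≡1+a
    rightward : ∀ b → crosses (cell a b) ≡ does (next (cell a b) ≟ᶠ cell a′ b)
    rightward b = crosses-toward _ _ (trans (row-cell a b) (sym (row-cell a′ b))) (inj₁ (col-cell a b , col-a′ b))
    leftward : ∀ b → crosses (cell a′ b) ≡ does (next (cell a′ b) ≟ᶠ cell a b)
    leftward b = crosses-toward _ _ (trans (row-cell a′ b) (sym (row-cell a b))) (inj₂ (col-a′ b , col-cell a b))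
    elsewhere : ∀ c → c ≢ a → c ≢ a′ → column-crossings c ≡ false
    elsewhere c c≢a c≢a′ = trans (sum-cong-≗ (λ b → crosses-elsewhere (cell c b) (≢a b) (≢a′ b))) (sum-replicate-zero (suc n′))
      where
      ≢a : ∀ b → col (cell c b) ≢ toℕ a
      ≢a b e = c≢a (toℕ-injective (trans (sym (col-cell c b)) e))
      ≢a′ : ∀ b → col (cell c b) ≢ suc (toℕ a)
      ≢a′ b e = c≢a′ (toℕ-injective (trans (sym (col-cell c b)) (trans e (sym a′≡1+a))))

  turn-linked-beyond : ∀ {a c e} → Turn C c → row a ≡ row c → row e ≡ row c →
    col c ≡ suc (col a) → col e ≡ suc (col c) → ¬ Linked a c → Linked c e
  turn-linked-beyond turn ra re ca ce a≁c with turn-horizontal-link turn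
  ... | j , c~j , rc≡rj with Linked-horizontal c~j rc≡rj
  ...   | inj₁ right = Linked-to-position c~j (trans (sym right) (sym ce)) (trans (sym rc≡rj) (sym re))
  ...   | inj₂ left  = ⊥-elim (a≁c (Linked-sym
          (Linked-to-position c~j (suc-injective (trans left ca)) (trans (sym rc≡rj) (sym ra)))))

  turn-column-pairs : ∀ X → (∀ p → col p ≡ X → Turn C p) →
    ∀ k {p q} → col p ≡ X → col q ≡ X → row p ≡ k * 2 → row q ≡ suc (k * 2) → Linked p q

  turn-column-link-up : ∀ X → (∀ p → col p ≡ X → Turn C p) →
    ∀ k {p j} → col p ≡ X → row p ≡ k * 2 → Linked p j → col p ≡ col j → suc (row p) ≡ row j

  turn-column-pairs X turn k cp cq rp rq with turn-vertical-link (turn _ cp)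
  ... | j , p~j , cp≡cj = Linked-to-position p~j (trans (sym cp≡cj) (trans cp (sym cq)))
          (trans (sym (turn-column-link-up X turn k cp rp p~j cp≡cj)) (trans (cong suc rp) (sym rq)))

  -- If the vertical edge at row 2k+2 went down, the turn at row 2k+1 would have a second vertical
  -- edge, as it is already linked to row 2k.
  turn-column-link-up X turn zero cp rp p~j cp≡cj with Linked-vertical p~j cp≡cj
  ... | inj₁ up   = up
  ... | inj₂ down = ⊥-elim (1+n≢0 (trans down rp))
  turn-column-link-up X turn (suc k) {p} {j} cp rp p~j cp≡cj with Linked-vertical p~j cp≡cj
  ... | inj₁ up   = up
  ... | inj₂ down = ⊥-elim (<-irrefl (trans (sym rp′) (trans (cong row p′≡p) rp))
                                    (≤-trans (n<1+n (k * 2)) (n≤1+n _)))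
    where
    cj : col j ≡ X
    cj = trans (sym cp≡cj) cp
    rj : row j ≡ suc (k * 2)
    rj = suc-injective (trans down rp)
    below : ∃ λ p′ → col p′ ≡ X × row p′ ≡ k * 2
    below = position-at (subst (_< suc m′) cj (toℕ<n (proj₁ (visit j))))
                        (<-trans (n<1+n (k * 2)) (subst (_< suc n′) rj (toℕ<n (proj₂ (visit j)))))
    p′ : Position
    p′ = proj₁ below
    cp′ : col p′ ≡ X
    cp′ = proj₁ (proj₂ below)
    rp′ : row p′ ≡ k * 2
    rp′ = proj₂ (proj₂ below)
    p′≡p : p′ ≡ p
    p′≡p = turn-vertical-link-unique (turn j cj) (Linked-sym (turn-column-pairs X turn k cp′ cj rp′ rj))
             (Linked-sym p~j) (trans cj (sym cp′)) (trans cj (sym cp))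

  module ThreeTurnColumns (x : ℕ) (x+2<m : x + 2 < suc m′)
                          (turns : ∀ p → x ≤ col p → col p ≤ x + 2 → Turn C p) where

    2+x<m : 2 + x < suc m′
    2+x<m = subst (_< suc m′) (+-comm x 2) x+2<m

    1+x<m : 1 + x < suc m′
    1+x<m = <-trans (n<1+n _) 2+x<m

    x<m : x < suc m′
    x<m = <-trans (n<1+n _) 1+x<m

    a₀ a₁ a₂ : Fin (suc m′)
    a₀ = fromℕ< x<m
    a₁ = fromℕ< 1+x<m
    a₂ = fromℕ< 2+x<m

    a₁-follows-a₀ : toℕ a₁ ≡ suc (toℕ a₀)
    a₁-follows-a₀ = trans (toℕ-fromℕ< 1+x<m) (cong suc (sym (toℕ-fromℕ< x<m)))

    col-a₀ : ∀ b → col (cell a₀ b) ≡ x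
    col-a₀ b = trans (col-cell a₀ b) (toℕ-fromℕ< x<m)

    col-a₁ : ∀ b → col (cell a₁ b) ≡ suc x
    col-a₁ b = trans (col-cell a₁ b) (toℕ-fromℕ< 1+x<m)

    col-a₂ : ∀ b → col (cell a₂ b) ≡ suc (suc x)
    col-a₂ b = trans (col-cell a₂ b) (toℕ-fromℕ< 2+x<m)

    column-of-turns : ∀ d → d ≤ 2 → ∀ p → col p ≡ d + x → Turn C p
    column-of-turns d d≤2 p cp = turns p (subst (x ≤_) (sym cp) (m≤n+m x d))
      (subst (_≤ x + 2) (sym cp) (≤-trans (+-monoˡ-≤ x d≤2) (≤-reflexive (+-comm 2 x))))

    apart : ∀ {p q c} → col p ≡ suc c → col q ≡ c → p ≢ q
    apart cp cq refl = 1+n≢n (trans (sym cp) cq)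

    links-across-pair : ∀ k (r r′ : Fin (suc n′)) → toℕ r ≡ k * 2 → toℕ r′ ≡ suc (k * 2) →
      links (cell a₀ r) (cell a₁ r) xor links (cell a₀ r′) (cell a₁ r′) ≡ true
    links-across-pair k r r′ r≡2k r′≡2k+1 = exactly-one (links a c) (links b d) refl refl
      where
      a b c d e f : Position
      a = cell a₀ r
      b = cell a₀ r′
      c = cell a₁ r
      d = cell a₁ r′
      e = cell a₂ r
      f = cell a₂ r′
      row-r : ∀ a → row (cell a r) ≡ k * 2
      row-r a = trans (row-cell a r) r≡2k
      row-r′ : ∀ a → row (cell a r′) ≡ suc (k * 2)
      row-r′ a = trans (row-cell a r′) r′≡2k+1
      a~b : Linked a b
      a~b = turn-column-pairs x (column-of-turns 0 z≤n) k (col-a₀ r) (col-a₀ r′) (row-r a₀) (row-r′ a₀)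
      c~d : Linked c d
      c~d = turn-column-pairs (suc x) (column-of-turns 1 (s≤s z≤n)) k (col-a₁ r) (col-a₁ r′) (row-r a₁) (row-r′ a₁)
      e~f : Linked e f
      e~f = turn-column-pairs (suc (suc x)) (column-of-turns 2 (s≤s (s≤s z≤n))) k
              (col-a₂ r) (col-a₂ r′) (row-r a₂) (row-r′ a₂)
      beyond : ∀ s → ¬ Linked (cell a₀ s) (cell a₁ s) → Linked (cell a₁ s) (cell a₂ s)
      beyond s = turn-linked-beyond (column-of-turns 1 (s≤s z≤n) _ (col-a₁ s))
        (trans (row-cell a₀ s) (sym (row-cell a₁ s))) (trans (row-cell a₂ s) (sym (row-cell a₁ s)))
        (trans (col-a₁ s) (cong suc (sym (col-a₀ s)))) (trans (col-a₂ s) (cong suc (sym (col-a₁ s))))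
      exactly-one : ∀ u v → links a c ≡ u → links b d ≡ v → u xor v ≡ true
      exactly-one true  false _ _ = refl
      exactly-one false true  _ _ = refl
      exactly-one true  true  ac bd =
        ⊥-elim (no-4-cycle (Linked-sym (links-true⇒Linked a c ac)) a~b (links-true⇒Linked b d bd) (Linked-sym c~d)
                           (apart (col-a₁ r) (col-a₀ r′)) (≢-sym (apart (col-a₁ r′) (col-a₀ r))))
      exactly-one false false ac bd =
        ⊥-elim (no-4-cycle (beyond r (links-false⇒¬Linked a c ac)) e~f
                           (Linked-sym (beyond r′ (links-false⇒¬Linked b d bd))) (Linked-sym c~d)
                           (≢-sym (apart (col-a₂ r′) (col-a₁ r))) (apart (col-a₂ r) (col-a₁ r′)))

CycSucc? : ∀ {L} (i j : Fin L) → Dec (CycSucc i j)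
CycSucc? {L} i j = (suc (toℕ i) ≟ℕ toℕ j) ⊎-dec ((suc (toℕ i) ≟ℕ L) ×-dec (toℕ j ≟ℕ 0))

Turn? : ∀ {m n} (C : HamiltonCycle m n) i → Dec (Turn C i)
Turn? C i = any? λ h → any? λ j → CycSucc? h i ×-dec (CycSucc? i j ×-dec
    (((proj₂ (visit h) ≟ᶠ proj₂ (visit i)) ×-dec (proj₁ (visit i) ≟ᶠ proj₁ (visit j)))
     ⊎-dec ((proj₁ (visit h) ≟ᶠ proj₁ (visit i)) ×-dec (proj₂ (visit i) ≟ᶠ proj₂ (visit j)))))
  where open HamiltonCycle C

straight-or-all-turns : ∀ {m n} (C : HamiltonCycle m n) lo hi →
  let open HamiltonCycle C in
  (∃ λ i → (lo ≤ toℕ (proj₁ (visit i)) × toℕ (proj₁ (visit i)) ≤ hi) × Straight C i)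
  ⊎ (∀ i → lo ≤ toℕ (proj₁ (visit i)) → toℕ (proj₁ (visit i)) ≤ hi → Turn C i)
straight-or-all-turns C lo hi with any? (λ i → (lo ≤? column i ×-dec column i ≤? hi) ×-dec ¬? (Turn? C i))
  where
  column : Fin _ → ℕ
  column i = toℕ (proj₁ (HamiltonCycle.visit C i))
... | yes straight = inj₁ straight
... | no  none     = inj₂ (λ i lo≤ ≤hi → decidable-stable (Turn? C i) (λ ¬turn → none (i , (lo≤ , ≤hi) , ¬turn)))

%4≡2⇒odd*2 : ∀ n → n % 4 ≡ 2 → ∃ λ q → n ≡ suc (q * 2) * 2
%4≡2⇒odd*2 n n%4≡2 = n / 4 , trans (m≡m%n+[m/n]*n n 4) (cong₂ _+_ n%4≡2 (sym (*-assoc (n / 4) 2 2)))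

no-three-turn-columns : ∀ m′ q (C : HamiltonCycle (suc m′) (suc (q * 2) * 2)) x → x + 2 < suc m′ →
  (∀ i → x ≤ toℕ (proj₁ (HamiltonCycle.visit C i)) → toℕ (proj₁ (HamiltonCycle.visit C i)) ≤ x + 2 → Turn C i) →
  ⊥
no-three-turn-columns m′ q C x x+2<m turns = false≢true (begin
  false
    ≡⟨ even-links-across a₀ a₁ a₁-follows-a₀ ⟨
  sum (λ b → links (cell a₀ b) (cell a₁ b))
    ≡⟨ sum-pairs (suc (q * 2)) (λ b → links (cell a₀ b) (cell a₁ b)) links-across-pair ⟩
  odd (suc (q * 2))
    ≡⟨ cong not (odd-*2 q) ⟩
  true ∎)
  where
  open ≡-Reasoning
  false≢true : false ≢ true
  false≢true ()
  2≤m′ : 2 ≤ m′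
  2≤m′ = ≤-trans (m≤n+m 2 x) (s≤s⁻¹ x+2<m)
  long : 4 ≤ suc ((q * 2) * 2) + m′ * suc (suc ((q * 2) * 2))
  long = ≤-trans (*-mono-≤ 2≤m′ (s≤s (s≤s z≤n))) (m≤n+m _ _)
  open HamiltonCycleProperties m′ (suc ((q * 2) * 2)) C long
  open ThreeTurnColumns x x+2<m turns

lemma20 : (m n : ℕ) → n < m → n % 4 ≡ 2 → (C : HamiltonCycle m n) →
    (x : ℕ) → x + 2 < m →
      ∃ λ i → (x ≤ toℕ (proj₁ (HamiltonCycle.visit C i))
               × toℕ (proj₁ (HamiltonCycle.visit C i)) ≤ x + 2)
              × Straight C i
lemma20 zero     n _ _      C x ()
lemma20 (suc m′) n _ n%4≡2 C x x+2<m with %4≡2⇒odd*2 n n%4≡2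
... | q , refl with straight-or-all-turns C x (x + 2)
...   | inj₁ straight = straight
...   | inj₂ turns    = ⊥-elim (no-three-turn-columns m′ q C x x+2<m turns)
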